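{- Every sequent derivable in $\mathrm{NMVL}_R$ (from no additional sequents) has a derivation in $\mathrm{NMVL}_R$ that uses no application of the cut rule and no application of the resolution rule.
   Context: Fix a propositional language with a set of connectives, each connective $\ast$ having an arity $\ell$, and let $\mathcal{F}$ be its set of formulas. Fix truth values $V=\{v_1,\ldots,v_n\}$, $n\ge 2$. Each $\ell$-ary connective $\ast$ is given a non-deterministic truth table $\ast: V^\ell \to P(V)\setminus\{\emptyset\}$. A labelled formula is a pair $(\varphi,k)$ with $\varphi\in\mathcal{F}$, $k\in\{1,\ldots,n\}$. A sequent is $\Gamma\rightarrow\Delta$ with $\Gamma,\Delta$ finite (possibly empty) sets of labelled formulas; commas denote union. For $K\subseteq\{1,\dots,n\}$, $\overline{K}=\{1,\ldots,n\}\setminus K$ and $\{\varphi\}\times K=\{(\varphi,k):k\in K\}$. The calculus $\mathrm{NMVL}_R$ has axioms $(\psi,k)\rightarrow(\psi,k)$ for every formula $\psi$ and $k=1,\ldots,n$, and the following rules (for all finite sets $\Gamma,\Delta,\Delta',\Delta''$ of labelled formulas and formulas $\varphi$): - $k$-L-shift: from $\Gamma,(\varphi,k)\rightarrow\Delta$ infer $\Gamma\rightarrow\Delta,\{\varphi\}\times\overline{\{k\}}$; - $k',k''$-R-shift ($k'\ne k''$): from $\Gamma\rightarrow\Delta,(\varphi,k')$ infer $\Gamma,(\varphi,k'')\rightarrow\Delta$; - $k$-L-weakening: from $\Gamma\rightarrow\Delta$ infer $\Gamma,(\varphi,k)\rightarrow\Delta$; - $k$-R-weakening: from $\Gamma\rightarrow\Delta$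 infer $\Gamma\rightarrow\Delta,(\varphi,k)$; - $k$-cut: from $\Gamma\rightarrow\Delta,(\varphi,k)$ and $\Gamma,(\varphi,k)\rightarrow\Delta$ infer $\Gamma\rightarrow\Delta$; - $k',k''$-resolution ($k'\neq k''$): from $\Gamma\rightarrow\Delta',(\varphi,k')$ and $\Gamma\rightarrow\Delta'',(\varphi,k'')$ infer $\Gamma\rightarrow\Delta',\Delta''$; - table rules: for every connective $\ast$ of arity $\ell$, formulas $\varphi_1,\ldots,\varphi_\ell$ and $k_1,\ldots,k_\ell\in\{1,\dots,n\}$: from the premises $\Gamma\rightarrow\Delta,(\varphi_j,k_j)$, $j=1,\ldots,\ell$, infer $\Gamma\rightarrow\Delta,\{(\ast(\varphi_1,\ldots,\varphi_\ell),k): v_k\in\ast(v_{k_1},\ldots,v_{k_\ell})\}$. A sequent is derivable in $\mathrm{NMVL}_R$ if it has a derivation from the axioms using the rules. -}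

module Defs where

open import Data.Bool using (Bool; true)
open import Data.Nat using (ℕ)
open import Data.Fin using (Fin)
open import Data.Fin.Subset using (Subset; Nonempty)
open import Data.Fin.Subset.Properties using (_∈?_)
import Data.Fin
open import Data.List using (List; []; _∷_; _++_; map; filter; allFin)
open import Data.List.Relation.Unary.All using (All)
open import Data.List.Membership.Propositional using (_∈_)
open import Data.Vec using (Vec; lookup; toList; tabulate)
open import Data.Product using (_×_; _,_)
open import Function.Bundles using (_⇔_)
open import Relation.Binary.PropositionalEquality using (_≡_; _≢_)
open import Relation.Nullary using (¬?)
open import Relation.Nullary.Decidable using (does)

module Language (Conn : Set) (arity : Conn → ℕ) where

  data Formula : Set where
    var : ℕ → Formula
    app : (c : Conn) → Vec Formula (arity c) → Formula

  -- Non-deterministic truth tables over truth values v₁..vₙ (represented by Fin n):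
  -- each connective maps a vector of truth values to a subset of truth values.
  Tables : ℕ → Set
  Tables n = (c : Conn) → Vec (Fin n) (arity c) → Subset n

  NonemptyTables : ∀ {n} → Tables n → Set
  NonemptyTables {n} t = (c : Conn) (ks : Vec (Fin n) (arity c)) → Nonempty (t c ks)

  module Calculus (n : ℕ) (table : Tables n) where

    Labelled : Set
    Labelled = Formula × Fin n

    -- Finite sets of labelled formulas, represented by lists; they are identified
    -- up to having the same elements (see _≈S_ below).
    LSet : Set
    LSet = List Labelled

    Sequent : Set
    Sequent = LSet × LSet

    _≈set_ : LSet → LSet → Set
    A ≈set B = ∀ x → (x ∈ A) ⇔ (x ∈ B)

    _≈S_ : Sequent → Sequent → Set
    (Γ , Δ) ≈S (Γ' , Δ') = (Γ ≈set Γ') × (Δ ≈set Δ')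

    _×ˢ_ : Formula → Subset n → LSet
    φ ×ˢ K = map (φ ,_) (filter (_∈? K) (allFin n))

    _×others_ : Formula → Fin n → LSet
    φ ×others k = map (φ ,_) (filter (λ k' → ¬? (k' Data.Fin.≟ k)) (allFin n))

    data Step (cr : Bool) : Sequent → List Sequent → Set where
      axiom : ∀ (ψ : Formula) (k : Fin n) →
        Step cr ((ψ , k) ∷ [] , (ψ , k) ∷ []) []
      L-shift : ∀ (Γ Δ : LSet) (φ : Formula) (k : Fin n) →
        Step cr (Γ , Δ ++ (φ ×others k)) (((φ , k) ∷ Γ , Δ) ∷ [])
      R-shift : ∀ (Γ Δ : LSet) (φ : Formula) (k' k'' : Fin n) → k' ≢ k'' →
        Step cr ((φ , k'') ∷ Γ , Δ) ((Γ , (φ , k') ∷ Δ) ∷ [])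
      L-weakening : ∀ (Γ Δ : LSet) (φ : Formula) (k : Fin n) →
        Step cr ((φ , k) ∷ Γ , Δ) ((Γ , Δ) ∷ [])
      R-weakening : ∀ (Γ Δ : LSet) (φ : Formula) (k : Fin n) →
        Step cr (Γ , (φ , k) ∷ Δ) ((Γ , Δ) ∷ [])
      cut : cr ≡ true → ∀ (Γ Δ : LSet) (φ : Formula) (k : Fin n) →
        Step cr (Γ , Δ) ((Γ , (φ , k) ∷ Δ) ∷ ((φ , k) ∷ Γ , Δ) ∷ [])
      resolution : cr ≡ true → ∀ (Γ Δ' Δ'' : LSet) (φ : Formula) (k' k'' : Fin n) → k' ≢ k'' →
        Step cr (Γ , Δ' ++ Δ'') ((Γ , (φ , k') ∷ Δ') ∷ (Γ , (φ , k'') ∷ Δ'') ∷ [])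
      table-rule : ∀ (Γ Δ : LSet) (c : Conn) (φs : Vec Formula (arity c))
        (ks : Vec (Fin n) (arity c)) →
        Step cr (Γ , Δ ++ (app c φs ×ˢ table c ks))
          (toList (tabulate (λ j → (Γ , (lookup φs j , lookup ks j) ∷ Δ))))

    -- Derivability (sequents considered up to set equality of both sides).
    -- Derivable true: in NMVL_R;  Derivable false: without cut and resolution.
    data Derivable (cr : Bool) : Sequent → Set where
      by : ∀ {S S' : Sequent} {ps : List Sequent} →
        Step cr S' ps → S' ≈S S → All (Derivable cr) ps → Derivable cr S

{-# OPTIONS --safe #-}
-- A sequent Γ → Δ is equivalent to the one-sided sequent → Δ ∪ shifted Γ, where shifted Γ
-- replaces each (φ , k) ∈ Γ by {φ} × {k}ᶜ.  One-sided sequents have a calculus ⊢ with just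
-- two rules: any set containing all labels of some formula, and the table rule.  Cut and
-- resolution are both instances of one generalised cut (from ⊢ Δ ∪ {φ} × A and ⊢ Δ ∪ {φ} × B
-- with A ∩ B = ∅ infer ⊢ Δ), which is admissible by induction on φ and then on both
-- derivations.  In the principal case both sides introduce φ = ∗(φ₁, …, φₗ) by table rules at
-- label vectors ks and ks': if ks = ks', the labels of φ they produce lie in Δ because A and B
-- are disjoint; otherwise ks and ks' differ at some j, and one cuts φⱼ with labels {ks j} and
-- {ks' j}.  A ⊢-derivation of Δ ∪ shifted Γ is finally rebuilt as a cut-free derivation of
-- Γ → Δ from axioms, shifts, weakenings and table rules.
module Submission where

open import Defs
open import Level using (0ℓ)
open import Data.Bool using (true; false)
open import Data.Nat using (ℕ; zero; suc; _≤_; s≤s)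
open import Data.Fin using (Fin; zero; suc; _≟_)
open import Data.Fin.Subset using (Subset) renaming (_∈_ to _∈ˢ_)
open import Data.Fin.Subset.Properties using (_∈?_)
open import Data.Empty using (⊥; ⊥-elim)
open import Data.Unit.Polymorphic using (⊤)
open import Data.Product using (_×_; _,_; proj₂; ∃)
open import Data.Sum using (_⊎_; inj₁; inj₂; [_,_]′)
import Data.Sum as Sum
open import Data.List using (List; []; _∷_; _++_; allFin)
open import Data.List.Properties using (++-assoc; ++-identityʳ)
open import Data.List.Relation.Binary.Permutation.Propositional.Properties using () renaming (shift to ↭-shift)
open import Data.List.Relation.Unary.All using (All; []; _∷_)
import Data.List.Relation.Unary.All as All
open import Data.List.Relation.Unary.Any using (here; there)
open import Data.List.Membership.Propositional using (_∈_)
open import Data.List.Membership.Propositional.Properties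
  using (∈-map⁺; ∈-map⁻; ∈-++⁺ˡ; ∈-++⁺ʳ; ∈-++⁻; ∈-filter⁺; ∈-filter⁻; ∈-allFin)
open import Data.List.Relation.Binary.Subset.Propositional using (_⊆_)
open import Data.List.Relation.Binary.Subset.Propositional.Properties
  using (⊆-refl; xs⊆x∷xs; xs⊆xs++ys; xs⊆ys++xs; ∷⁺ʳ; ∈-∷⁺ʳ; ++⁺ˡ; ++⁺ʳ; ++⁺; ⊆-reflexive-↭)
open import Data.Vec using (Vec; lookup; toList; tabulate)
import Data.Vec as Vec
open import Data.Vec.Properties using (lookup∘tabulate)
import Data.Vec.Relation.Unary.All as VecAll
import Data.Vec.Relation.Unary.All.Properties as VecAll
open import Function using (_∘_)
open import Function.Bundles using (mk⇔; Equivalence)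
open import Relation.Binary.PropositionalEquality using (_≡_; _≢_; refl; sym; trans; subst)
open import Relation.Nullary using (yes; no; ¬?)
open import Relation.Unary using (Pred; ｛_｝; ∁)

∀⊎∃ : ∀ {m} {P Q : Pred (Fin m) 0ℓ} → (∀ k → P k ⊎ Q k) → (∀ k → P k) ⊎ ∃ Q
∀⊎∃ {zero}  _ = inj₁ λ ()
∀⊎∃ {suc m} f with f zero | ∀⊎∃ (f ∘ suc)
... | inj₂ q | _            = inj₂ (zero , q)
... | inj₁ _ | inj₂ (k , q) = inj₂ (suc k , q)
... | inj₁ p | inj₁ ps      = inj₁ λ { zero → p ; (suc k) → ps k }

∀∈⊎∃∈ : ∀ {m} {P Q : Pred (Fin m) 0ℓ} (K : Subset m) → (∀ k → k ∈ˢ K → P k ⊎ Q k) →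
        (∀ k → k ∈ˢ K → P k) ⊎ ∃ λ k → k ∈ˢ K × Q k
∀∈⊎∃∈ {P = P} {Q} K f = ∀⊎∃ choose
  where
  choose : ∀ k → (k ∈ˢ K → P k) ⊎ (k ∈ˢ K × Q k)
  choose k with k ∈? K
  ... | no  k∉K = inj₁ (⊥-elim ∘ k∉K)
  ... | yes k∈K = Sum.map (λ p _ → p) (k∈K ,_) (f k k∈K)

≡⊎∃≢ : ∀ {n m} (xs ys : Vec (Fin n) m) → xs ≡ ys ⊎ ∃ λ j → lookup xs j ≢ lookup ys j
≡⊎∃≢ Vec.[]       Vec.[]       = inj₁ refl
≡⊎∃≢ (x Vec.∷ xs) (y Vec.∷ ys) with x ≟ y | ≡⊎∃≢ xs ys
... | no x≢y   | _              = inj₂ (zero , x≢y)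
... | yes refl | inj₁ refl      = inj₁ refl
... | yes refl | inj₂ (j , x≢y) = inj₂ (suc j , x≢y)

Disjoint : ∀ {a} {A : Set a} → Pred A 0ℓ → Pred A 0ℓ → Set a
Disjoint P Q = ∀ x → P x → Q x → ⊥

module _ {a p} {A : Set a} {P : Pred A p} where

  ∈-++-elim : ∀ xs {ys} → (∀ {x} → x ∈ xs → P x) → (∀ {x} → x ∈ ys → P x) →
              ∀ {x} → x ∈ xs ++ ys → P x
  ∈-++-elim xs f g m = [ f , g ]′ (∈-++⁻ xs m)

  All-tabulate⁺ : ∀ {m} (f : Fin m → A) → (∀ j → P (f j)) → All P (toList (tabulate f))
  All-tabulate⁺ f Pf =
    VecAll.toList⁺ (VecAll.lookup⁻ λ j → subst P (sym (lookup∘tabulate f j)) (Pf j))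

  All-tabulate⁻ : ∀ {m} (f : Fin m → A) → All P (toList (tabulate f)) → ∀ j → P (f j)
  All-tabulate⁻ f Pfs j = subst P (lookup∘tabulate f j) (VecAll.lookup⁺ (VecAll.toList⁻ Pfs) j)

module CutElimination (Conn : Set) (arity : Conn → ℕ) (n : ℕ)
                      (table : Language.Tables Conn arity n) where

  open Language Conn arity
  open Calculus n table

  ∈-×others⁺ : ∀ {φ k k'} → k' ≢ k → (φ , k') ∈ φ ×others k
  ∈-×others⁺ {φ} {k} {k'} k'≢k =
    ∈-map⁺ (φ ,_) (∈-filter⁺ (λ k'' → ¬? (k'' ≟ k)) (∈-allFin k') k'≢k)

  ∈-×others⁻ : ∀ {φ k x} → x ∈ φ ×others k → ∃ λ k' → k' ≢ k × x ≡ (φ , k')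
  ∈-×others⁻ {φ} {k} m with ∈-map⁻ (φ ,_) m
  ... | k' , m' , refl = k' , proj₂ (∈-filter⁻ (λ k'' → ¬? (k'' ≟ k)) {xs = allFin n} m') , refl

  ∈-×ˢ⁺ : ∀ {φ K k} → k ∈ˢ K → (φ , k) ∈ φ ×ˢ K
  ∈-×ˢ⁺ {φ} {K} {k} k∈K = ∈-map⁺ (φ ,_) (∈-filter⁺ (_∈? K) (∈-allFin k) k∈K)

  ∈-×ˢ⁻ : ∀ {φ K x} → x ∈ φ ×ˢ K → ∃ λ k → k ∈ˢ K × x ≡ (φ , k)
  ∈-×ˢ⁻ {φ} {K} m with ∈-map⁻ (φ ,_) m
  ... | k , m' , refl = k , proj₂ (∈-filter⁻ (_∈? K) {xs = allFin n} m') , refl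

  data ⊢_ (X : LSet) : Set where
    all-labels  : (φ : Formula) → (∀ k → (φ , k) ∈ X) → ⊢ X
    table-intro : (c : Conn) (φs : Vec Formula (arity c)) (ks : Vec (Fin n) (arity c)) →
                  (∀ k → k ∈ˢ table c ks → (app c φs , k) ∈ X) →
                  (∀ j → ⊢ ((lookup φs j , lookup ks j) ∷ X)) → ⊢ X

  ⊢-mono : ∀ {X Y} → X ⊆ Y → ⊢ X → ⊢ Y
  ⊢-mono X⊆Y (all-labels φ h) = all-labels φ (X⊆Y ∘ h)
  ⊢-mono X⊆Y (table-intro c φs ks h ⊢premise) =
    table-intro c φs ks (λ k → X⊆Y ∘ h k) (λ j → ⊢-mono (∷⁺ʳ _ X⊆Y) (⊢premise j))

  infix 4 _∈_∪_⨯_ _⊆_∪_⨯_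

  _∈_∪_⨯_ : Labelled → LSet → Formula → Pred (Fin n) 0ℓ → Set
  x ∈ Δ ∪ φ ⨯ A = x ∈ Δ ⊎ ∃ λ k → x ≡ (φ , k) × A k

  _⊆_∪_⨯_ : LSet → LSet → Formula → Pred (Fin n) 0ℓ → Set
  X ⊆ Δ ∪ φ ⨯ A = ∀ {x} → x ∈ X → x ∈ Δ ∪ φ ⨯ A

  ∈∪⨯-label : ∀ {Δ φ A k} → (φ , k) ∈ Δ ∪ φ ⨯ A → (φ , k) ∈ Δ ⊎ A k
  ∈∪⨯-label (inj₁ m)              = inj₁ m
  ∈∪⨯-label (inj₂ (_ , refl , a)) = inj₂ a

  ⊆∪⨯-∷⁺ : ∀ {x X Δ φ A} → X ⊆ Δ ∪ φ ⨯ A → x ∷ X ⊆ x ∷ Δ ∪ φ ⨯ A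
  ⊆∪⨯-∷⁺ X⊆ (here refl) = inj₁ (here refl)
  ⊆∪⨯-∷⁺ X⊆ (there m)   = Sum.map₁ there (X⊆ m)

  ⊆∪⨯-∷ʳ : ∀ {x X Δ φ A} → X ⊆ Δ ∪ φ ⨯ A → X ⊆ x ∷ Δ ∪ φ ⨯ A
  ⊆∪⨯-∷ʳ X⊆ m = Sum.map₁ there (X⊆ m)

  ∷-⊆∪⨯ : ∀ {Δ' Δ φ k} → Δ' ⊆ Δ → (φ , k) ∷ Δ' ⊆ Δ ∪ φ ⨯ ｛ k ｝
  ∷-⊆∪⨯ Δ'⊆Δ (here refl) = inj₂ (_ , refl , refl)
  ∷-⊆∪⨯ Δ'⊆Δ (there m)   = inj₁ (Δ'⊆Δ m)

  ×others-⊆∪⨯ : ∀ {Δ φ k} → φ ×others k ⊆ Δ ∪ φ ⨯ ∁ ｛ k ｝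
  ×others-⊆∪⨯ m with ∈-×others⁻ m
  ... | k' , k'≢k , refl = inj₂ (k' , refl , k'≢k ∘ sym)

  disjoint-⊎-elim : ∀ {A B : Pred (Fin n) 0ℓ} {P : Set} → Disjoint A B →
                    ∀ k → P ⊎ A k → P ⊎ B k → P
  disjoint-⊎-elim _     _ (inj₁ p) _        = p
  disjoint-⊎-elim _     _ (inj₂ _) (inj₁ p) = p
  disjoint-⊎-elim A∩B=∅ k (inj₂ a) (inj₂ b) = ⊥-elim (A∩B=∅ k a b)

  Cut : Formula → Set₁
  Cut φ = ∀ {A B Δ X Y} → Disjoint A B → X ⊆ Δ ∪ φ ⨯ A → Y ⊆ Δ ∪ φ ⨯ B → ⊢ X → ⊢ Y → ⊢ Δ

  CutBelow : Formula → Set₁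
  CutBelow (var _)    = ⊤
  CutBelow (app c φs) = ∀ j → Cut (lookup φs j)

  module _ {c : Conn} {φs : Vec Formula (arity c)} {ks : Vec (Fin n) (arity c)}
           {A B : Pred (Fin n) 0ℓ} (cutBelow : CutBelow (app c φs)) (A∩B=∅ : Disjoint A B)
           where

    private
      φ : Formula
      φ = app c φs

      Premises : LSet → Set
      Premises Δ = ∀ j → ⊢ ((lookup φs j , lookup ks j) ∷ Δ)

      PrincipalWith : Pred (Fin n) 0ℓ → LSet → Set
      PrincipalWith P Δ = ∀ k → k ∈ˢ table c ks → (φ , k) ∈ Δ ⊎ P k

      both-principal : ∀ {Δ} → Premises Δ → PrincipalWith A Δ → PrincipalWith B Δ → ⊢ Δ
      both-principal ⊢premise inΔ⊎A inΔ⊎B =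
        table-intro c φs ks (λ k k∈ → disjoint-⊎-elim A∩B=∅ k (inΔ⊎A k k∈) (inΔ⊎B k k∈)) ⊢premise

    principal-cut-all-labels : ∀ {Δ Y χ} → Premises Δ → PrincipalWith A Δ →
      Y ⊆ Δ ∪ φ ⨯ B → (∀ k → (χ , k) ∈ Y) → ⊢ Δ
    principal-cut-all-labels ⊢premise inΔ⊎A Y⊆ h with ∀⊎∃ (λ k → Y⊆ (h k))
    ... | inj₁ inΔ = all-labels _ inΔ
    ... | inj₂ (_ , _ , refl , _) =
      both-principal ⊢premise inΔ⊎A (λ k _ → ∈∪⨯-label (Y⊆ (h k)))

    principal-cut-table-intro : ∀ {Δ Y c' χs ks'} → Premises Δ → PrincipalWith A Δ →
      Y ⊆ Δ ∪ φ ⨯ B → (∀ k → k ∈ˢ table c' ks' → (app c' χs , k) ∈ Y) →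
      (∀ j → ⊢ ((lookup χs j , lookup ks' j) ∷ Δ)) → ⊢ Δ
    principal-cut-table-intro {c' = c'} {χs} {ks'} ⊢premise inΔ⊎A Y⊆ h ⊢premise'
      with ∀∈⊎∃∈ (table c' ks') (λ k k∈ → Y⊆ (h k k∈))
    ... | inj₁ inΔ = table-intro c' χs ks' inΔ ⊢premise'
    ... | inj₂ (_ , _ , _ , refl , _) with ≡⊎∃≢ ks ks'
    ...   | inj₁ refl = both-principal ⊢premise inΔ⊎A (λ k k∈ → ∈∪⨯-label (Y⊆ (h k k∈)))
    ...   | inj₂ (j , ks≢ks') =
      cutBelow j (λ _ p q → ks≢ks' (trans p (sym q)))
        (∷-⊆∪⨯ ⊆-refl) (∷-⊆∪⨯ ⊆-refl) (⊢premise j) (⊢premise' j)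

    principal-cut : ∀ {Δ Y} → Premises Δ → PrincipalWith A Δ → Y ⊆ Δ ∪ φ ⨯ B → ⊢ Y → ⊢ Δ
    principal-cut ⊢premise inΔ⊎A Y⊆ (all-labels _ h) =
      principal-cut-all-labels ⊢premise inΔ⊎A Y⊆ h
    principal-cut {Δ} ⊢premise inΔ⊎A Y⊆ (table-intro _ _ _ h ⊢premise') =
      principal-cut-table-intro ⊢premise inΔ⊎A Y⊆ h λ j →
        principal-cut (⊢-mono (∷⁺ʳ _ (xs⊆x∷xs Δ _)) ∘ ⊢premise)
                      (λ k k∈ → Sum.map₁ there (inΔ⊎A k k∈)) (⊆∪⨯-∷⁺ Y⊆) (⊢premise' j)

  cut-all-labels : ∀ {φ χ A B Δ X Y} → Disjoint A B → (∀ k → (χ , k) ∈ X) →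
    X ⊆ Δ ∪ φ ⨯ A → Y ⊆ Δ ∪ φ ⨯ B → ⊢ Y → ⊢ Δ
  cut-all-labels {Δ = Δ} {Y = Y} A∩B=∅ h X⊆ Y⊆ ⊢Y with ∀⊎∃ (λ k → X⊆ (h k))
  ... | inj₁ inΔ = all-labels _ inΔ
  ... | inj₂ (_ , _ , refl , _) = ⊢-mono Y⊆Δ ⊢Y
    where
    Y⊆Δ : Y ⊆ Δ
    Y⊆Δ m with Y⊆ m
    ... | inj₁ inΔ            = inΔ
    ... | inj₂ (k , refl , b) = disjoint-⊎-elim A∩B=∅ k (∈∪⨯-label (X⊆ (h k))) (inj₂ b)

  cut-table-intro : ∀ {φ c φs ks A B Δ X Y} → CutBelow φ → Disjoint A B →
    (∀ k → k ∈ˢ table c ks → (app c φs , k) ∈ X) →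
    (∀ j → ⊢ ((lookup φs j , lookup ks j) ∷ Δ)) →
    X ⊆ Δ ∪ φ ⨯ A → Y ⊆ Δ ∪ φ ⨯ B → ⊢ Y → ⊢ Δ
  cut-table-intro {c = c} {φs} {ks} cutBelow A∩B=∅ h ⊢premise X⊆ Y⊆ ⊢Y
    with ∀∈⊎∃∈ (table c ks) (λ k k∈ → X⊆ (h k k∈))
  ... | inj₁ inΔ = table-intro c φs ks inΔ ⊢premise
  ... | inj₂ (_ , _ , _ , refl , _) =
    principal-cut cutBelow A∩B=∅ ⊢premise (λ k k∈ → ∈∪⨯-label (X⊆ (h k k∈))) Y⊆ ⊢Y

  cut-from-below : ∀ φ → CutBelow φ → Cut φ
  cut-from-below φ cutBelow A∩B=∅ X⊆ Y⊆ (all-labels _ h) ⊢Y =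
    cut-all-labels A∩B=∅ h X⊆ Y⊆ ⊢Y
  cut-from-below φ cutBelow A∩B=∅ X⊆ Y⊆ (table-intro _ _ _ h ⊢premise) ⊢Y =
    cut-table-intro cutBelow A∩B=∅ h
      (λ j → cut-from-below φ cutBelow A∩B=∅ (⊆∪⨯-∷⁺ X⊆) (⊆∪⨯-∷ʳ Y⊆) (⊢premise j) ⊢Y)
      X⊆ Y⊆ ⊢Y

  -- ⊢-cut-args makes the recursion into the immediate subformulas structural.
  ⊢-cut : ∀ φ → Cut φ
  ⊢-cut-args : ∀ {m} (φs : Vec Formula m) j → Cut (lookup φs j)
  ⊢-cut (var p)    = cut-from-below (var p) _
  ⊢-cut (app c φs) = cut-from-below (app c φs) (⊢-cut-args φs)
  ⊢-cut-args (φ Vec.∷ _)  zero    = ⊢-cut φ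
  ⊢-cut-args (_ Vec.∷ φs) (suc j) = ⊢-cut-args φs j

  shifted : LSet → LSet
  shifted []            = []
  shifted ((φ , k) ∷ Γ) = φ ×others k ++ shifted Γ

  ShiftOf : LSet → Labelled → Set
  ShiftOf Γ (φ , k') = ∃ λ k → (φ , k) ∈ Γ × k' ≢ k

  ∈-shifted⁺ : ∀ {Γ φ k'} → ShiftOf Γ (φ , k') → (φ , k') ∈ shifted Γ
  ∈-shifted⁺ {_ ∷ _} (k , here refl , k'≢k) = ∈-++⁺ˡ (∈-×others⁺ k'≢k)
  ∈-shifted⁺ {_ ∷ _} (k , there m   , k'≢k) = ∈-++⁺ʳ _ (∈-shifted⁺ (k , m , k'≢k))

  ∈-shifted⁻ : ∀ {Γ φ k'} → (φ , k') ∈ shifted Γ → ShiftOf Γ (φ , k')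
  ∈-shifted⁻ {(ψ , j) ∷ Γ} m with ∈-++⁻ (ψ ×others j) m
  ... | inj₁ m' with ∈-×others⁻ m'
  ...   | _ , k'≢j , refl = j , here refl , k'≢j
  ∈-shifted⁻ {(ψ , j) ∷ Γ} m | inj₂ m' with ∈-shifted⁻ m'
  ...   | k , m'' , k'≢k = k , there m'' , k'≢k

  shifted-mono : ∀ {Γ Γ'} → Γ ⊆ Γ' → shifted Γ ⊆ shifted Γ'
  shifted-mono Γ⊆Γ' {φ , k'} m with ∈-shifted⁻ m
  ... | k , m' , k'≢k = ∈-shifted⁺ (k , Γ⊆Γ' m' , k'≢k)

  flatten : Sequent → LSet
  flatten (Γ , Δ) = Δ ++ shifted Γ

  flatten-mono : ∀ {Γ Δ Γ' Δ'} → Γ ⊆ Γ' → Δ ⊆ Δ' → flatten (Γ , Δ) ⊆ flatten (Γ' , Δ')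
  flatten-mono Γ⊆Γ' Δ⊆Δ' = ++⁺ Δ⊆Δ' (shifted-mono Γ⊆Γ')

  step-admissible : ∀ {cr S ps} → Step cr S ps → All (⊢_ ∘ flatten) ps → ⊢ flatten S
  step-admissible (axiom ψ k) [] = all-labels ψ labels
    where
    labels : ∀ k' → (ψ , k') ∈ flatten ((ψ , k) ∷ [] , (ψ , k) ∷ [])
    labels k' with k' ≟ k
    ... | yes refl = here refl
    ... | no k'≢k  = there (∈-++⁺ˡ (∈-×others⁺ k'≢k))
  step-admissible (L-shift Γ Δ φ k) (⊢premise ∷ []) =
    subst ⊢_ (sym (++-assoc Δ (φ ×others k) (shifted Γ))) ⊢premise
  step-admissible (R-shift Γ Δ φ k' k'' k'≢k'') (⊢premise ∷ []) =
    ⊢-mono (∈-∷⁺ʳ (∈-++⁺ʳ Δ (∈-++⁺ˡ (∈-×others⁺ k'≢k''))) (++⁺ʳ Δ (xs⊆ys++xs _ _))) ⊢premise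
  step-admissible (L-weakening Γ Δ φ k) (⊢premise ∷ []) =
    ⊢-mono (++⁺ʳ Δ (xs⊆ys++xs _ _)) ⊢premise
  step-admissible (R-weakening Γ Δ φ k) (⊢premise ∷ []) =
    ⊢-mono (xs⊆x∷xs _ _) ⊢premise
  step-admissible (cut _ Γ Δ φ k) (⊢left ∷ ⊢right ∷ []) =
    ⊢-cut φ (λ _ k≡ k≢ → k≢ k≡) (∷-⊆∪⨯ ⊆-refl)
      (∈-++-elim Δ (inj₁ ∘ xs⊆xs++ys Δ _)
        (∈-++-elim (φ ×others k) ×others-⊆∪⨯ (inj₁ ∘ xs⊆ys++xs _ Δ)))
      ⊢left ⊢right
  step-admissible (resolution _ Γ Δ' Δ'' φ k' k'' k'≢k'') (⊢left ∷ ⊢right ∷ []) =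
    ⊢-cut φ (λ _ p q → k'≢k'' (trans p (sym q)))
      (∷-⊆∪⨯ (++⁺ˡ _ (xs⊆xs++ys Δ' Δ''))) (∷-⊆∪⨯ (++⁺ˡ _ (xs⊆ys++xs Δ'' Δ')))
      ⊢left ⊢right
  step-admissible (table-rule Γ Δ c φs ks) ⊢premises =
    table-intro c φs ks (λ _ k∈ → ∈-++⁺ˡ (∈-++⁺ʳ Δ (∈-×ˢ⁺ k∈)))
      (λ j → ⊢-mono (∷⁺ʳ _ (++⁺ˡ (shifted Γ) (xs⊆xs++ys Δ _))) (All-tabulate⁻ _ ⊢premises j))

  derivable⇒⊢ : ∀ {cr S} → Derivable cr S → ⊢ flatten S
  derivable*⇒⊢ : ∀ {cr Ss} → All (Derivable cr) Ss → All (⊢_ ∘ flatten) Ss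
  derivable⇒⊢ (by {_ , _} {_ , _} step (Γ'≈Γ , Δ'≈Δ) ⊢premises) =
    ⊢-mono (flatten-mono (Equivalence.to (Γ'≈Γ _)) (Equivalence.to (Δ'≈Δ _)))
      (step-admissible step (derivable*⇒⊢ ⊢premises))
  derivable*⇒⊢ []       = []
  derivable*⇒⊢ (d ∷ ds) = derivable⇒⊢ d ∷ derivable*⇒⊢ ds

  ⊆⊇⇒≈set : ∀ {X Y} → X ⊆ Y → Y ⊆ X → X ≈set Y
  ⊆⊇⇒≈set X⊆Y Y⊆X _ = mk⇔ X⊆Y Y⊆X

  ≈set-refl : ∀ {X} → X ≈set X
  ≈set-refl = ⊆⊇⇒≈set ⊆-refl ⊆-refl

  ≈set-trans : ∀ {X Y Z} → X ≈set Y → Y ≈set Z → X ≈set Z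
  ≈set-trans X≈Y Y≈Z x = mk⇔ (to (Y≈Z x) ∘ to (X≈Y x)) (from (X≈Y x) ∘ from (Y≈Z x))
    where open Equivalence

  ≈S-refl : ∀ {S} → S ≈S S
  ≈S-refl = ≈set-refl , ≈set-refl

  Derivable-resp-≈S : ∀ {cr S S'} → Derivable cr S → S ≈S S' → Derivable cr S'
  Derivable-resp-≈S (by {_ , _} {_ , _} step (Γ₀≈Γ , Δ₀≈Δ) ds) (Γ≈Γ' , Δ≈Δ') =
    by step (≈set-trans Γ₀≈Γ Γ≈Γ' , ≈set-trans Δ₀≈Δ Δ≈Δ') ds

  CutFree : Sequent → Set
  CutFree = Derivable false

  weaken-++ : ∀ Γ' Δ' {Γ Δ} → CutFree (Γ , Δ) → CutFree (Γ' ++ Γ , Δ' ++ Δ)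
  weaken-++ [] [] d = d
  weaken-++ [] ((φ , k) ∷ Δ') d = by (R-weakening _ _ φ k) ≈S-refl (weaken-++ [] Δ' d ∷ [])
  weaken-++ ((φ , k) ∷ Γ') Δ' d = by (L-weakening _ _ φ k) ≈S-refl (weaken-++ Γ' Δ' d ∷ [])

  weaken : ∀ {Γ Δ Γ' Δ'} → CutFree (Γ , Δ) → Γ ⊆ Γ' → Δ ⊆ Δ' → CutFree (Γ' , Δ')
  weaken {Γ' = Γ'} {Δ'} d Γ⊆Γ' Δ⊆Δ' =
    Derivable-resp-≈S (weaken-++ Γ' Δ' d)
      ( ⊆⊇⇒≈set (∈-++-elim Γ' (λ m → m) Γ⊆Γ') (xs⊆xs++ys Γ' _)
      , ⊆⊇⇒≈set (∈-++-elim Δ' (λ m → m) Δ⊆Δ') (xs⊆xs++ys Δ' _))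

  unshift : ∀ {Γ Δ φ k'} → ShiftOf Γ (φ , k') → CutFree (Γ , (φ , k') ∷ Δ) → CutFree (Γ , Δ)
  unshift {Γ} {Δ} {φ} {k'} (k , φk∈Γ , k'≢k) d =
    by (R-shift Γ Δ φ k' k k'≢k) (⊆⊇⇒≈set (∈-∷⁺ʳ φk∈Γ ⊆-refl) (xs⊆x∷xs Γ _) , ≈set-refl) (d ∷ [])

  unshift* : ∀ {Γ Δ M} → All (ShiftOf Γ) M → CutFree (Γ , Δ ++ M) → CutFree (Γ , Δ)
  unshift* {Γ} {Δ} [] d = subst (λ Δ → CutFree (Γ , Δ)) (++-identityʳ Δ) d
  unshift* {Δ = Δ} {x ∷ M} (s ∷ ss) d =
    unshift* ss (unshift s (weaken d ⊆-refl (⊆-reflexive-↭ (↭-shift x Δ M))))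

  ⊢⇒cut-free-one-sided : Fin n → ∀ {X} → ⊢ X → CutFree ([] , X)
  ⊢⇒cut-free-one-sided k₀ {X} (all-labels φ h) =
    weaken (by (L-shift [] ((φ , k₀) ∷ []) φ k₀) ≈S-refl (by (axiom φ k₀) ≈S-refl [] ∷ []))
      ⊆-refl (∈-∷⁺ʳ (h k₀) others⊆X)
    where
    others⊆X : φ ×others k₀ ⊆ X
    others⊆X m with ∈-×others⁻ m
    ... | k , _ , refl = h k
  ⊢⇒cut-free-one-sided k₀ {X} (table-intro c φs ks h ⊢premise) =
    weaken (by (table-rule [] X c φs ks) ≈S-refl
             (All-tabulate⁺ _ λ j → ⊢⇒cut-free-one-sided k₀ (⊢premise j)))
      ⊆-refl (∈-++-elim X (λ m → m) principal⊆X)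
    where
    principal⊆X : app c φs ×ˢ table c ks ⊆ X
    principal⊆X m with ∈-×ˢ⁻ m
    ... | k , k∈ , refl = h k k∈

  ⊢⇒cut-free : Fin n → ∀ {Γ Δ} → ⊢ flatten (Γ , Δ) → CutFree (Γ , Δ)
  ⊢⇒cut-free k₀ ⊢ΓΔ =
    unshift* (All.tabulate ∈-shifted⁻) (weaken (⊢⇒cut-free-one-sided k₀ ⊢ΓΔ) (λ ()) ⊆-refl)

  cut-elimination : Fin n → ∀ {S} → Derivable true S → CutFree S
  cut-elimination k₀ {_ , _} = ⊢⇒cut-free k₀ ∘ derivable⇒⊢

theorem2 : (Conn : Set) (arity : Conn → ℕ) (n : ℕ) → 2 ≤ n →
    (table : Language.Tables Conn arity n) → Language.NonemptyTables Conn arity table →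
    (S : Language.Calculus.Sequent Conn arity n table) →
    Language.Calculus.Derivable Conn arity n table true S →
    Language.Calculus.Derivable Conn arity n table false S
theorem2 Conn arity (suc n) (s≤s _) table _ S =
  CutElimination.cut-elimination Conn arity (suc n) table zero
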